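{- Let $p,q$ be relatively prime positive integers and $\tilde p,\tilde q$ relatively prime positive integers with $\tilde p\ge p$ and $\tilde q\ge q$. Then $L(p,q)\le L(\tilde p,\tilde q)$; that is, $L(p,q)$ is increasing as a function of $p$ and as a function of $q$.
   Context: For relatively prime positive integers $p,q$ let $\Delta_0(p,q)=\{(a,b)\in\mathbb N^2: p(a+1)+q(b+1)\le pq\}$ (the lattice points of the triangle bounded by the line $p(X+1)+q(Y+1)=pq$ and the coordinate axes). A lattice path of the $(p,q)$-system is a path in this triangle starting on the $Y$-axis, ending on the $X$-axis and using only right or downward unit steps; equivalently it is encoded by the set $L$ of lattice points in the region bounded by the path and the coordinate axes, which is a nonempty finite subset $L\subseteq\Delta_0(p,q)$ such that $(a,b)\in L$, $a'\le a$, $b'\le b$, $a',b'\in\mathbb N$ imply $(a',b')\in L$. The path is admissible if: (a) whenever $(a,b),(a',b')\in L$ with $a+a'\ge q-1$, then $(a+a'-q+1,\,b+b'+1)\in L$; and (b) whenever $(a,b),(a',b')\in L$ with $b+b'\ge p-1$, then $(a+a'+1,\,b+b'-p+1)\in L$. $L(p,q)$ denotes the number of admissible lattice paths of the $(p,q)$-system. -}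

module Defs where

open import Data.Nat using (ℕ; zero; suc; _+_; _*_; _∸_; _≤_; _≤?_)
open import Data.Nat.Properties using () renaming (_≟_ to _≟ℕ_)
open import Data.Product using (_×_; _,_)
open import Data.Product.Properties using (≡-dec)
open import Data.List using (List; []; _∷_; map; _++_; filter; length; upTo; cartesianProduct)
open import Data.List.Relation.Unary.All using (All; all?)
open import Relation.Nullary using (Dec; ¬_; _×-dec_; _→-dec_; ¬?)
open import Relation.Binary.PropositionalEquality using (_≡_)
open import Relation.Binary using (DecidableEquality)

Point : Set
Point = ℕ × ℕ

_≟P_ : DecidableEquality Point
_≟P_ = ≡-dec _≟ℕ_ _≟ℕ_

open import Data.List.Membership.DecPropositional _≟P_ public using (_∈_; _∈?_)

InΔ₀ : ℕ → ℕ → Point → Set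
InΔ₀ p q (a , b) = p * (a + 1) + q * (b + 1) ≤ p * q

-- Δ₀(p,q) as an explicit duplicate-free list; every point of Δ₀ has a < q and b < p
Δ₀ : ℕ → ℕ → List Point
Δ₀ p q = filter (λ { (a , b) → p * (a + 1) + q * (b + 1) ≤? p * q })
                (cartesianProduct (upTo q) (upTo p))

-- all sublists (= all subsets, for a duplicate-free list)
sublists : {A : Set} → List A → List (List A)
sublists []       = [] ∷ []
sublists (x ∷ xs) = sublists xs ++ map (x ∷_) (sublists xs)

NonEmpty : List Point → Set
NonEmpty []      = Data.Empty.⊥ where import Data.Empty
NonEmpty (_ ∷ _) = Data.Unit.⊤ where import Data.Unit

DownClosed : List Point → Set
DownClosed L = All (λ { (a , b) → All (λ a' → All (λ b' → (a' , b') ∈ L) (upTo (suc b))) (upTo (suc a)) }) L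

CondA : ℕ → List Point → Set
CondA q L = All (λ { (a , b) → All (λ { (a' , b') →
              (q ∸ 1 ≤ a + a' → (a + a' + 1 ∸ q , b + b' + 1) ∈ L) }) L }) L

CondB : ℕ → List Point → Set
CondB p L = All (λ { (a , b) → All (λ { (a' , b') →
              (p ∸ 1 ≤ b + b' → (a + a' + 1 , b + b' + 1 ∸ p) ∈ L) }) L }) L

-- an admissible lattice path of the (p,q)-system, encoded by its set L ⊆ Δ₀(p,q)
-- (L ⊆ Δ₀ is guaranteed by ranging over sublists of Δ₀ p q below)
AdmissiblePath : ℕ → ℕ → List Point → Set
AdmissiblePath p q L = NonEmpty L × DownClosed L × CondA q L × CondB p L

nonEmpty? : (L : List Point) → Dec (NonEmpty L)
nonEmpty? []      = Relation.Nullary.no (λ ())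
nonEmpty? (_ ∷ _) = Relation.Nullary.yes Data.Unit.tt where import Data.Unit

admissible? : (p q : ℕ) → (L : List Point) → Dec (AdmissiblePath p q L)
admissible? p q L =
  nonEmpty? L ×-dec
  (all? (λ { (a , b) → all? (λ a' → all? (λ b' → (a' , b') ∈? L) (upTo (suc b))) (upTo (suc a)) }) L ×-dec
  (all? (λ { (a , b) → all? (λ { (a' , b') → (q ∸ 1 ≤? a + a') →-dec ((a + a' + 1 ∸ q , b + b' + 1) ∈? L) }) L }) L ×-dec
   all? (λ { (a , b) → all? (λ { (a' , b') → (p ∸ 1 ≤? b + b') →-dec ((a + a' + 1 , b + b' + 1 ∸ p) ∈? L) }) L }) L))

Lcount : ℕ → ℕ → ℕ
Lcount p q = length (filter (admissible? p q) (sublists (Δ₀ p q)))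

-- Δ₀(p,q) ⊆ Δ₀(p̃,q̃): points of Δ₀(p,q) have a + 1 ≤ q, so raising p by d raises
-- p(a+1) by at most dq = pq's increase (symmetrically for q).  So every candidate
-- set L for (p,q) is one for (p̃,q̃).
-- Moreover an admissible L stays admissible: the point that condition (a) for q̃
-- demands, (a + a' + 1 − q̃, b + b' + 1), lies below the one demanded for q
-- (and its trigger a + a' ≥ q̃ − 1 implies a + a' ≥ q − 1), so it lies in L by
-- down-closure; likewise for (b).  Hence the admissible sets for (p,q) form a
-- sublist of those for (p̃,q̃).
module Submission where

open import Defs
open import Data.Nat using (ℕ; _≤_; _<_)
open import Data.Nat.Coprimality using (Coprime)

open import Data.Nat using (suc; _+_; _*_; z≤n; s≤s)
open import Data.Nat.Properties
open import Data.Product using (_,_)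
open import Data.List using (List; []; _∷_; map; applyUpTo; cartesianProduct)
open import Data.List.Relation.Binary.Sublist.Propositional using (_⊆_; []; _∷_; _∷ʳ_; minimum)
open import Data.List.Relation.Binary.Sublist.Propositional.Properties
  using (++⁺; ++⁺ˡ; ++⁺ʳ; map⁺; filter⁺; length-mono-≤)
open import Data.List.Relation.Unary.All using (tabulate; lookup)
open import Data.List.Membership.Propositional.Properties using (∈-upTo⁺)
open import Relation.Binary.PropositionalEquality using (refl; cong; subst₂)
open import Algebra.Properties.CommutativeSemigroup +-commutativeSemigroup using (xy∙z≈xz∙y)

private
  variable
    A B : Set

applyUpTo⁺ : (f : ℕ → A) {m n : ℕ} → m ≤ n → applyUpTo f m ⊆ applyUpTo f n
applyUpTo⁺ f z≤n      = minimum _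
applyUpTo⁺ f (s≤s m≤n) = refl ∷ applyUpTo⁺ (λ k → f (suc k)) m≤n

cartesianProduct⁺ : {xs xs' : List A} {ys ys' : List B} →
                    xs ⊆ xs' → ys ⊆ ys' → cartesianProduct xs ys ⊆ cartesianProduct xs' ys'
cartesianProduct⁺ []                            _  = []
cartesianProduct⁺ {ys' = ys'} (x ∷ʳ xs⊆xs')     ys⊆ys' =
  ++⁺ˡ (map (x ,_) ys') (cartesianProduct⁺ xs⊆xs' ys⊆ys')
cartesianProduct⁺ {xs = x ∷ _} (refl ∷ xs⊆xs') ys⊆ys' =
  ++⁺ (map⁺ (x ,_) ys⊆ys') (cartesianProduct⁺ xs⊆xs' ys⊆ys')

sublists⁺ : {xs ys : List A} → xs ⊆ ys → sublists xs ⊆ sublists ys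
sublists⁺ []                       = refl ∷ []
sublists⁺ {ys = y ∷ ys} (y ∷ʳ xs⊆ys) = ++⁺ʳ (map (y ∷_) (sublists ys)) (sublists⁺ xs⊆ys)
sublists⁺ {xs = x ∷ _} (refl ∷ xs⊆ys) = ++⁺ (sublists⁺ xs⊆ys) (map⁺ (x ∷_) (sublists⁺ xs⊆ys))

InΔ₀-swap : ∀ {p q a b} → InΔ₀ p q (a , b) → InΔ₀ q p (b , a)
InΔ₀-swap {p} {q} {a} {b} = subst₂ _≤_ (+-comm (p * (a + 1)) (q * (b + 1))) (*-comm p q)

InΔ₀⇒<ˡ : ∀ {p q a b} → 0 < p → InΔ₀ p q (a , b) → a < q
InΔ₀⇒<ˡ {suc p} {q} {a} {b} _ h =
  subst₂ _≤_ (+-comm a 1) refl (*-cancelˡ-≤ (suc p) (≤-trans (m≤m+n _ (q * (b + 1))) h))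

InΔ₀-monoˡ : ∀ {p p̃ q a b} → p ≤ p̃ → a < q → InΔ₀ p q (a , b) → InΔ₀ p̃ q (a , b)
InΔ₀-monoˡ {p} {p̃} {q} {a} {b} p≤p̃ a<q h with m≤n⇒∃[o]m+o≡n p≤p̃
... | d , refl = begin
  (p + d) * (a + 1) + q * (b + 1)         ≡⟨ cong (_+ q * (b + 1)) (*-distribʳ-+ (a + 1) p d) ⟩
  p * (a + 1) + d * (a + 1) + q * (b + 1) ≡⟨ xy∙z≈xz∙y (p * (a + 1)) _ _ ⟩
  p * (a + 1) + q * (b + 1) + d * (a + 1) ≤⟨ +-mono-≤ h (*-monoʳ-≤ d (subst₂ _≤_ (+-comm 1 a) refl a<q)) ⟩
  p * q + d * q                           ≡⟨ *-distribʳ-+ q p d ⟨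
  (p + d) * q                             ∎
  where open ≤-Reasoning

InΔ₀-mono : ∀ {p p̃ q q̃ a b} → 0 < p → 0 < q → p ≤ p̃ → q ≤ q̃ →
            InΔ₀ p q (a , b) → InΔ₀ p̃ q̃ (a , b)
InΔ₀-mono {p} {p̃} {q} {q̃} {a} {b} 0<p 0<q p≤p̃ q≤q̃ h =
  InΔ₀-monoˡ p≤p̃ (≤-trans (InΔ₀⇒<ˡ {p} {q} 0<p h) q≤q̃) (InΔ₀-swap {q̃} {p} {b} {a} hq̃)
  where
  hq̃ : InΔ₀ q̃ p (b , a)
  hq̃ = InΔ₀-monoˡ q≤q̃ (InΔ₀⇒<ˡ {q} {p} 0<q (InΔ₀-swap {p} {q} h)) (InΔ₀-swap {p} {q} h)

Δ₀⁺ : ∀ {p p̃ q q̃} → 0 < p → 0 < q → p ≤ p̃ → q ≤ q̃ → Δ₀ p q ⊆ Δ₀ p̃ q̃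
Δ₀⁺ 0<p 0<q p≤p̃ q≤q̃ =
  filter⁺ _ _ (λ { {a , b} refl → InΔ₀-mono 0<p 0<q p≤p̃ q≤q̃ })
    (cartesianProduct⁺ (applyUpTo⁺ (λ k → k) q≤q̃) (applyUpTo⁺ (λ k → k) p≤p̃))

DownClosed⇒∈ : ∀ {L a b a' b'} → DownClosed L → (a , b) ∈ L → a' ≤ a → b' ≤ b → (a' , b') ∈ L
DownClosed⇒∈ dc ab∈L a'≤a b'≤b =
  lookup (lookup (lookup dc ab∈L) (∈-upTo⁺ (s≤s a'≤a))) (∈-upTo⁺ (s≤s b'≤b))

CondA-mono : ∀ {q q̃ L} → q ≤ q̃ → DownClosed L → CondA q L → CondA q̃ L
CondA-mono q≤q̃ dc condA = tabulate λ { {a , b} ab∈L → tabulate λ { {a' , b'} a'b'∈L trigger →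
  DownClosed⇒∈ dc (lookup (lookup condA ab∈L) a'b'∈L (≤-trans (∸-monoˡ-≤ 1 q≤q̃) trigger))
    (∸-monoʳ-≤ (a + a' + 1) q≤q̃) ≤-refl } }

CondB-mono : ∀ {p p̃ L} → p ≤ p̃ → DownClosed L → CondB p L → CondB p̃ L
CondB-mono p≤p̃ dc condB = tabulate λ { {a , b} ab∈L → tabulate λ { {a' , b'} a'b'∈L trigger →
  DownClosed⇒∈ dc (lookup (lookup condB ab∈L) a'b'∈L (≤-trans (∸-monoˡ-≤ 1 p≤p̃) trigger))
    ≤-refl (∸-monoʳ-≤ (b + b' + 1) p≤p̃) } }

AdmissiblePath-mono : ∀ {p p̃ q q̃ L} → p ≤ p̃ → q ≤ q̃ → AdmissiblePath p q L → AdmissiblePath p̃ q̃ L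
AdmissiblePath-mono p≤p̃ q≤q̃ (nonEmpty , dc , condA , condB) =
  nonEmpty , dc , CondA-mono q≤q̃ dc condA , CondB-mono p≤p̃ dc condB

lemma5p1 : (p q p̃ q̃ : ℕ) → 0 < p → 0 < q → 0 < p̃ → 0 < q̃ →
           Coprime p q → Coprime p̃ q̃ → p ≤ p̃ → q ≤ q̃ →
           Lcount p q ≤ Lcount p̃ q̃
lemma5p1 p q p̃ q̃ 0<p 0<q _ _ _ _ p≤p̃ q≤q̃ =
  length-mono-≤ (filter⁺ (admissible? p q) (admissible? p̃ q̃)
    (λ { refl → AdmissiblePath-mono p≤p̃ q≤q̃ })
    (sublists⁺ (Δ₀⁺ 0<p 0<q p≤p̃ q≤q̃)))
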